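{- Let $G$ be a tree on $k$ vertices, $n\ge1$, $e$ an edge of $G$, and let $\{u,v\}$ be a non-special edge of an $e$-cycle of length $2^i$ in $\Gamma^G_n$. Then \[ n(u,v)\,n(v,u) = k^{i-1}\left(k^n-k^{i-1}\right), \] where $n(\cdot,\cdot)$ is computed in $\Gamma^G_n$.
   Context: Let $G$ be a finite tree with vertex set $V$, $|V|=k$, and fix an orientation of each edge. For an oriented edge $e=(s,t)$ of $G$ define a bijection $e$ of the set $V^n$ of words of length $n$ over $V$ recursively: $e$ fixes the empty word, and for a letter $z\in V$ and a word $w$, $e(sw)=t\,e(w)$, $e(tw)=sw$, and $e(zw)=zw$ for $z\notin\{s,t\}$. The $n$-th Schreier graph $\Gamma^G_n$ is the multigraph with vertex set $V^n$ having, for each word $u\in V^n$ and each edge $e$ of $G$, one edge labelled $e$ joining $u$ and $e(u)$. The edges labelled $e$ decompose into one cycle per orbit of $e$ on $V^n$ (a loop for a fixed point, two parallel edges for an orbit of size $2$); these are the $e$-cycles. Every $e$-cycle $C$ of length $2^i$ with $i\ge1$ has vertex set $\{xw : x\in\{s,t\}^i\}$ for a word $w$ of length $n-i$ whose first letter (if $i<n$) is not in $\{s,t\}$. The special edges of $C$ are the edge labelled $e$ joining $s^iw$ and $t^iw$ and the edge labelled $e$ joining $s^{i-1}tw$ and $t^{i-1}sw$; all other edges of $C$ are non-special. For adjacent vertices $u,v$, $n(u,v)$ denotes the number of vertices strictly closer (in graph distance) to $u$ than to $v$. -}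

module Defs where

open import Data.Nat using (ℕ; zero; suc; _+_)
open import Data.Fin using (Fin; _≟_)
open import Data.Bool using (Bool; true; false; if_then_else_)
open import Data.Vec using (Vec; []; _∷_; _++_; map; replicate; _∷ʳ_)
open import Data.List using (List; length)
open import Data.List.Membership.Propositional using (_∈_)
open import Data.List.Relation.Unary.Unique.Propositional using (Unique)
open import Data.Product using (_×_; _,_; Σ; ∃)
open import Data.Sum using (_⊎_)
open import Data.Unit using (⊤)
open import Relation.Nullary using (¬_; yes; no)
open import Relation.Binary.PropositionalEquality using (_≡_; _≢_)

OEdge : ℕ → Set
OEdge k = Fin k × Fin k

data Reachable {k : ℕ} (E : List (OEdge k)) : Fin k → Fin k → Set where
  refl  : ∀ {a} → Reachable E a a
  fwd   : ∀ {a b c} → (a , b) ∈ E → Reachable E b c → Reachable E a c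
  bwd   : ∀ {a b c} → (b , a) ∈ E → Reachable E b c → Reachable E a c

-- A tree on vertex set Fin k, given by its list of oriented edges:
-- connected with exactly k - 1 edges (equivalently, connected and acyclic).
IsTree : (k : ℕ) → List (OEdge k) → Set
IsTree k E = (length E + 1 ≡ k) × (∀ a b → Reachable E a b)

Word : ℕ → ℕ → Set
Word k n = Vec (Fin k) n

act : ∀ {k n} → OEdge k → Word k n → Word k n
act e [] = []
act (s , t) (z ∷ w) with z ≟ s | z ≟ t
... | yes _ | _     = t ∷ act (s , t) w
... | no _  | yes _ = s ∷ w
... | no _  | no _  = z ∷ w

-- Adjacency in the Schreier graph Γ^G_n (edge labelled e joining x and e(x)).
Adj : ∀ {k n} → List (OEdge k) → Word k n → Word k n → Set
Adj E x y = ∃ λ e → e ∈ E × (act e x ≡ y ⊎ act e y ≡ x)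

data Walk≤ {k n : ℕ} (E : List (OEdge k)) : ℕ → Word k n → Word k n → Set where
  stop : ∀ {m x} → Walk≤ E m x x
  step : ∀ {m x y z} → Adj E x y → Walk≤ E m y z → Walk≤ E (suc m) x z

-- w is strictly closer to u than to v: d(w,u) < d(w,v).
Closer : ∀ {k n} → List (OEdge k) → Word k n → Word k n → Word k n → Set
Closer E u v w = ∃ λ m → Walk≤ E m w u × ¬ Walk≤ E m w v

HasCount : {A : Set} → (A → Set) → ℕ → Set
HasCount {A} P N = Σ (List A) λ L →
  Unique L × (∀ a → (a ∈ L → P a) × (P a → a ∈ L)) × length L ≡ N

FirstNotIn : ∀ {k j} → Fin k → Fin k → Word k j → Set
FirstNotIn s t []      = ⊤
FirstNotIn s t (z ∷ _) = z ≢ s × z ≢ t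

stWord : ∀ {k i} → Fin k → Fin k → Vec Bool i → Word k i
stWord s t = map (λ b → if b then t else s)

-- The edge (labelled e) from x w to e(x w) is special iff x = s^i or x = s^(i-1) t.
SpecialPattern : ∀ {i} → Vec Bool (suc i) → Set
SpecialPattern {i} x = x ≡ replicate (suc i) false ⊎ x ≡ (replicate i false ∷ʳ true)

-- Let C be the e-cycle through u, of length 2h. Removing e from the tree G splits its vertices into
-- two sides, and this attaches every word z to a vertex `position z` of C: z keeps its position
-- along every edge of Γ except the e-edges of C. Cut C along the edge uv and the opposite edge a′b′
-- (a′ on the side of u) into two arcs of h vertices. A walk from above the arc of u to v crosses uv
-- or a′b′; in the second case it still needs h - 1 steps from b′ to v, because the distance along C
-- to a′b′ changes by at most one along any edge of Γ, whereas a′ reaches u in h - 1 steps. Either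
-- way a strictly shorter walk reaches u, and symmetrically from the arc of v to u, so the vertices
-- closer to u are exactly those above its arc. The words not ending in w, and those whose letter
-- just before w is outside {s, t}, all lie above s⋯s w or t⋯t w; for a non-special edge one of the
-- two arcs contains neither vertex, and a word y l w with y of length i lies above that arc for
-- exactly one l ∈ {s, t}. So that arc carries k^i words and the other one k^n - k^i.

module Submission where

open import Defs
open import Data.Nat
  using (ℕ; zero; suc; pred; NonZero; >-nonZero; _+_; _*_; _∸_; _^_; _≤_; _<_; z≤n; s≤s; _≤?_; _<?_)
open import Data.Nat.Properties
  using ( suc-injective; suc-pred; +-suc; +-assoc; +-comm; +-identityʳ; *-suc; *-comm; *-distribˡ-+
        ; m^n≢0; even≢odd; m+n∸m≡n; m+n∸n≡m; m∸n+n≡m; +-∸-assoc; n∸n≡0; pred[m∸n]≡m∸[1+n]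
        ; ≤-refl; ≤-reflexive; ≤-trans; ≤-antisym; <-trans; ≤-<-trans; <-≤-trans; <-cmp
        ; <⇒≤; <⇒≱; ≰⇒>; ≮⇒≥; ≤∧≢⇒<; ≤-pred; m≤n⇒m≤1+n; m≤n⇒m<n∨m≡n; n≤1+n; n<1+n; m≤n+m; m≤m+n; m<m+n
        ; +-monoʳ-≤; +-monoˡ-≤; +-mono-≤; *-monoʳ-≤; +-cancelʳ-≤; +-cancelʳ-<; *-cancelˡ-≡; *-cancelˡ-<)
open import Relation.Binary.Definitions using (tri<; tri≈; tri>)
open import Data.Nat.Tactic.RingSolver using (solve-∀)
open import Data.Fin using (Fin; zero; suc; punchIn; punchOut) renaming (_≟_ to _≟ᶠ_)
open import Data.Fin.Properties using (punchOut-cong; punchOut-punchIn; punchInᵢ≢i)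
open import Data.Vec using (Vec; []; _∷_; _∷ʳ_; _++_; replicate; take; drop; initLast)
open import Data.Vec.Properties
  using (∷-injective; ∷ʳ-injectiveˡ; ++-injectiveˡ; ++-injectiveʳ; take++drop≡id) renaming (≡-dec to ≡-decᵛ)
open import Data.List using (List; []; _∷_; [_]; length; filter; map; allFin; cartesianProductWith)
open import Data.List using () renaming (_++_ to _++ᴸ_)
open import Data.List.Properties using (length-++; length-map; length-tabulate; filter-notAll)
open import Data.List.Relation.Unary.Any using (here; any?)
open import Data.List.Membership.Propositional using (_∈_; find; lose)
open import Data.List.Membership.Propositional.Properties
  using (∈-map⁺; ∈-map⁻; ∈-filter⁺; ∈-filter⁻; ∈-++⁺ˡ; ∈-++⁺ʳ; ∈-allFin; ∈-cartesianProductWith⁺)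
open import Data.List.Membership.Propositional.Properties.WithK using (unique∧set⇒bag)
open import Data.List.Relation.Unary.Unique.Propositional using (Unique; []; _∷_)
open import Data.List.Relation.Unary.All using ([])
import Data.List.Relation.Unary.Unique.Propositional.Properties as Unique
open import Data.List.Relation.Binary.BagAndSetEquality using (∼bag⇒↭)
open import Data.List.Relation.Binary.Permutation.Propositional.Properties using (↭-length)
open import Data.Product using (_×_; _,_; proj₁; proj₂; ∃-syntax; ∃₂)
open import Data.Product.Properties using () renaming (≡-dec to ≡-dec×)
open import Data.Sum using (_⊎_; inj₁; inj₂; swap; [_,_]′) renaming (map to map⊎)
open import Data.Unit using (⊤; tt)
open import Data.Bool using (Bool; true; false; if_then_else_)
open import Data.Maybe using (Maybe; just; nothing; fromMaybe; _<∣>_)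
open import Data.Maybe.Properties using (<∣>-identityʳ)
open import Function using (id; _∘_; _⇔_; mk⇔; Equivalence)
open import Function.Properties.Equivalence using () renaming (sym to ⇔-sym)
open import Relation.Nullary using (¬_; ¬?; yes; no; contradiction)
open import Relation.Nullary.Decidable using (_⊎-dec_; _×-dec_; decidable-stable)
open import Relation.Unary using (Decidable; ∁)
open import Relation.Unary.Properties using (∁?)
open import Relation.Binary.PropositionalEquality
  using (_≡_; _≢_; refl; sym; trans; cong; cong₂; subst; subst₂; module ≡-Reasoning)
import Relation.Binary.Definitions as Binary

-- Counting

module _ {A : Set} where

  HasCount-cong : {P Q : A → Set} {N : ℕ} → (∀ a → P a ⇔ Q a) → HasCount P N → HasCount Q N
  HasCount-cong P⇔Q (L , unique , members , length≡) =
    L , unique , (λ a → Equivalence.to (P⇔Q a) ∘ proj₁ (members a) ,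
                        proj₂ (members a) ∘ Equivalence.from (P⇔Q a)) , length≡

  HasCount-functional : {P : A → Set} {N M : ℕ} → HasCount P N → HasCount P M → N ≡ M
  HasCount-functional (L , uL , mL , refl) (K , uK , mK , refl) =
    ↭-length (∼bag⇒↭ (unique∧set⇒bag uL uK (mk⇔ (L⊆K _) (K⊆L _))))
    where
    L⊆K : ∀ a → a ∈ L → a ∈ K
    L⊆K a = proj₂ (mK a) ∘ proj₁ (mL a)
    K⊆L : ∀ a → a ∈ K → a ∈ L
    K⊆L a = proj₂ (mL a) ∘ proj₁ (mK a)

  HasCount-∁ : {P : A → Set} {N T : ℕ} → Decidable P →
    HasCount P N → HasCount (λ _ → ⊤) T → HasCount (∁ P) (T ∸ N)
  HasCount-∁ {P} {T = T} P? (L , uL , mL , refl) all@(U , uU , mU , _) =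
    L∁ , Unique.filter⁺ (∁? P?) uU , (λ a → ∁P∈L∁ a , ∈-L∁ a) , length-L∁
    where
    L∁ = filter (∁? P?) U
    ∁P∈L∁ : ∀ a → a ∈ L∁ → ∁ P a
    ∁P∈L∁ a = proj₂ ∘ ∈-filter⁻ (∁? P?) {xs = U}
    ∈-L∁ : ∀ a → ∁ P a → a ∈ L∁
    ∈-L∁ a = ∈-filter⁺ (∁? P?) (proj₂ (mU a) tt)
    ∈-L++L∁ : ∀ a → a ∈ L ++ᴸ L∁
    ∈-L++L∁ a with P? a
    ... | yes Pa = ∈-++⁺ˡ (proj₂ (mL a) Pa)
    ... | no ¬Pa = ∈-++⁺ʳ L (∈-L∁ a ¬Pa)
    L++L∁ : HasCount (λ _ → ⊤) (length L + length L∁)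
    L++L∁ = L ++ᴸ L∁ ,
            Unique.++⁺ uL (Unique.filter⁺ (∁? P?) uU)
                       (λ (a∈L , a∈L∁) → ∁P∈L∁ _ a∈L∁ (proj₁ (mL _) a∈L)) ,
            (λ a → (λ _ → tt) , (λ _ → ∈-L++L∁ a)) , length-++ L
    length-L∁ : length L∁ ≡ T ∸ length L
    length-L∁ = sym (trans (cong (_∸ length L) (sym (HasCount-functional L++L∁ all)))
                           (m+n∸m≡n (length L) (length L∁)))

length-cartesianProductWith : {A B C : Set} (f : A → B → C) (xs : List A) (ys : List B) →
  length (cartesianProductWith f xs ys) ≡ length xs * length ys
length-cartesianProductWith f [] ys = refl
length-cartesianProductWith f (x ∷ xs) ys =
  trans (length-++ (map (f x) ys)) (cong₂ _+_ (length-map (f x) ys) (length-cartesianProductWith f xs ys))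

words : ∀ k n → List (Word k n)
words k zero    = [ [] ]
words k (suc n) = cartesianProductWith _∷_ (allFin k) (words k n)

∈-words : ∀ {k n} (z : Word k n) → z ∈ words k n
∈-words []      = here refl
∈-words (c ∷ z) = ∈-cartesianProductWith⁺ _∷_ (∈-allFin c) (∈-words z)

words-unique : ∀ k n → Unique (words k n)
words-unique k zero    = [] ∷ []
words-unique k (suc n) = Unique.cartesianProductWith⁺ _∷_ ∷-injective (Unique.allFin⁺ k) (words-unique k n)

length-words : ∀ k n → length (words k n) ≡ k ^ n
length-words k zero    = refl
length-words k (suc n) = trans (length-cartesianProductWith _∷_ (allFin k) (words k n))
                               (cong₂ _*_ (length-tabulate {n = k} id) (length-words k n))

HasCount-words : ∀ k n → HasCount (λ (_ : Word k n) → ⊤) (k ^ n)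
HasCount-words k n = words k n , words-unique k n , (λ z → (λ _ → tt) , (λ _ → ∈-words z)) , length-words k n

-- Walks in Γ

_≟ʷ_ : ∀ {k n} → Binary.DecidableEquality (Word k n)
_≟ʷ_ = ≡-decᵛ _≟ᶠ_

module Walks {k n : ℕ} (E : List (OEdge k)) where

  private
    V = Word k n
    variable
      m m′ : ℕ
      x y z : V

  Adj-sym : Adj E x y → Adj E y x
  Adj-sym (e , e∈E , inj₁ ex≡y) = e , e∈E , inj₂ ex≡y
  Adj-sym (e , e∈E , inj₂ ey≡x) = e , e∈E , inj₁ ey≡x

  walk-weaken : m ≤ m′ → Walk≤ E m x y → Walk≤ E m′ x y
  walk-weaken _       stop       = stop
  walk-weaken (s≤s p) (step a w) = step a (walk-weaken p w)

  walk-++ : Walk≤ E m x y → Walk≤ E m′ y z → Walk≤ E (m + m′) x z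
  walk-++ {m = m} {m′ = m′} stop w = walk-weaken (m≤n+m m′ m) w
  walk-++ (step a w₁) w₂ = step a (walk-++ w₁ w₂)

  walk-∷ʳ : Walk≤ E m x y → Adj E y z → Walk≤ E (suc m) x z
  walk-∷ʳ stop       a′ = step a′ stop
  walk-∷ʳ (step a w) a′ = step a (walk-∷ʳ w a′)

  walk-reverse : Walk≤ E m x y → Walk≤ E m y x
  walk-reverse stop       = stop
  walk-reverse (step a w) = walk-∷ʳ (walk-reverse w) (Adj-sym a)

  adj? : Binary.Decidable (Adj {n = n} E)
  adj? x y with any? (λ e → (act e x ≟ʷ y) ⊎-dec (act e y ≟ʷ x)) E
  ... | yes p = let (e , e∈E , moves) = find p in yes (e , e∈E , moves)
  ... | no ¬p = no λ (e , e∈E , moves) → ¬p (lose e∈E moves)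

  walk? : ∀ m → Binary.Decidable (Walk≤ {n = n} E m)
  walk? m x y with x ≟ʷ y
  walk? m x .x   | yes refl = yes stop
  walk? zero x y | no x≢y = no λ { stop → x≢y refl }
  walk? (suc m) x y | no x≢y with any? (λ x′ → adj? x x′ ×-dec walk? m x′ y) (words k n)
  ... | yes p = let (_ , _ , a , w) = find p in yes (step a w)
  ... | no ¬p = no λ { stop → x≢y refl ; (step {y = x′} a w) → ¬p (lose (∈-words x′) (a , w)) }

  walk-potential : (Φ : V → ℕ) → (∀ {x y} → Adj E x y → Φ x ≤ suc (Φ y)) →
    Walk≤ E m x y → Φ x ≤ m + Φ y
  walk-potential Φ lipschitz stop       = m≤n+m _ _
  walk-potential Φ lipschitz (step a w) = ≤-trans (lipschitz a) (s≤s (walk-potential Φ lipschitz w))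

  record Exit (Q : V → Set) (m : ℕ) (z b : V) : Set where
    field
      {last-inside first-outside} : V
      {before after} : ℕ
      to-exit       : Walk≤ E before z last-inside
      exit-edge     : Adj E last-inside first-outside
      inside        : Q last-inside
      outside       : ¬ Q first-outside
      from-exit     : Walk≤ E after first-outside b
      length-split  : m ≡ suc (before + after)

  first-exit : {Q : V → Set} → Decidable Q → Q z → ¬ Q y → Walk≤ E m z y → Exit Q m z y
  first-exit Q? Qz ¬Qy stop = contradiction Qz ¬Qy
  first-exit Q? Qz ¬Qy (step {y = z′} a w) with Q? z′
  ... | no ¬Qz′ = record { to-exit = stop ; exit-edge = a ; inside = Qz ; outside = ¬Qz′
                         ; from-exit = w ; length-split = refl }
  ... | yes Qz′ = let open Exit (first-exit Q? Qz′ ¬Qy w) in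
                  record { to-exit = step a to-exit ; exit-edge = exit-edge ; inside = inside
                         ; outside = outside ; from-exit = from-exit ; length-split = cong suc length-split }

  Shortcut : (V → Set) → V → V → Set
  Shortcut Q b a = ∀ {m z} → Q z → Walk≤ E m z b → ∃[ m′ ] m ≡ suc m′ × Walk≤ E m′ z a

  shortcut-through-gates : {Q : V → Set} → Decidable Q → {a b a′ b′ : V} {ℓ : ℕ} →
    (∀ {x y} → Adj E x y → Q x → ¬ Q y → (x ≡ a × y ≡ b) ⊎ (x ≡ a′ × y ≡ b′)) →
    ¬ Q b → Walk≤ E ℓ a′ a → (∀ {m} → Walk≤ E m b′ b → ℓ ≤ m) → Shortcut Q b a
  shortcut-through-gates Q? gates ¬Qb a′→a far Qz z→b
    with record { to-exit = z→x ; exit-edge = x∼y ; inside = Qx ; outside = ¬Qy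
                ; from-exit = y→b ; length-split = refl } ← first-exit Q? Qz ¬Qb z→b
    with gates x∼y Qx ¬Qy
  ... | inj₁ (refl , refl) = _ , refl , walk-weaken (m≤m+n _ _) z→x
  ... | inj₂ (refl , refl) = _ , refl , walk-weaken (+-monoʳ-≤ _ (far y→b)) (walk-++ z→x a′→a)

  module _ (connected : ∀ (x y : V) → ∃[ m ] Walk≤ E m x y) where

    closer-by-shortcut : {Q : V → Set} {u v z : V} → Shortcut Q v u → Q z → Closer E u v z
    closer-by-shortcut {u = u} {v} {z} to-u Qz = descend (proj₂ (connected z u))
      where
      descend : Walk≤ E m z u → Closer E u v z
      descend {m} z→u with walk? m z v
      ... | no ¬z→v = m , z→u , ¬z→v
      ... | yes z→v with to-u Qz z→v
      ...   | _ , refl , z→u′ = descend z→u′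

    not-closer-by-shortcut : {Q : V → Set} {u v z : V} → Shortcut Q u v → Q z → ¬ Closer E u v z
    not-closer-by-shortcut to-v Qz (m , z→u , ¬z→v) with to-v Qz z→u
    ... | _ , refl , z→v = ¬z→v (walk-weaken (m≤n+m _ 1) z→v)

    closer⇔ : {Q : V → Set} {u v : V} → Decidable Q → Shortcut Q v u → Shortcut (∁ Q) u v →
              ∀ z → (Closer E u v z ⇔ Q z) × (Closer E v u z ⇔ ∁ Q z)
    closer⇔ {Q} {u} {v} Q? to-u to-v z =
      mk⇔ closer-u⇒Q (closer-by-shortcut to-u) ,
      mk⇔ (λ closer-v Qz → not-closer-by-shortcut to-u Qz closer-v) (closer-by-shortcut to-v)
      where
      closer-u⇒Q : Closer E u v z → Q z
      closer-u⇒Q closer-u with Q? z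
      ... | yes Qz = Qz
      ... | no ¬Qz = contradiction closer-u (not-closer-by-shortcut to-v ¬Qz)

-- Graphs retracting onto an even cycle

module CycleRetraction {k n : ℕ} (E : List (OEdge k)) (h : ℕ)
  (pos : Word k n → ℕ) (vertex : ℕ → Word k n)
  (pos< : ∀ z → pos z < 2 * h)
  (pos-vertex : ∀ {p} → p < 2 * h → pos (vertex p) ≡ p)
  (vertex-periodic : ∀ p → vertex (p + 2 * h) ≡ vertex p)
  (vertex-adj : ∀ p → Adj E (vertex p) (vertex (suc p)))
  (adj-pos : ∀ {z y} → Adj E z y → pos z ≡ pos y
               ⊎ (z ≡ vertex (pos z) × y ≡ vertex (suc (pos z)))
               ⊎ (y ≡ vertex (pos y) × z ≡ vertex (suc (pos y))))
  (connected : ∀ (x y : Word k n) → ∃[ m ] Walk≤ E m x y)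
  where

  open Walks {n = n} E

  private
    variable
      m p : ℕ
      x y : Word k n

  walk-along : ∀ r p → Walk≤ E r (vertex p) (vertex (r + p))
  walk-along zero    p = stop
  walk-along (suc r) p = walk-∷ʳ (walk-along r p) (vertex-adj (r + p))

  pos-next : p < 2 * h → (suc p < 2 * h × pos (vertex (suc p)) ≡ suc p)
                       ⊎ (suc p ≡ 2 * h × pos (vertex (suc p)) ≡ 0)
  pos-next p<2h with m≤n⇒m<n∨m≡n p<2h
  ... | inj₁ 1+p<2h = inj₁ (1+p<2h , pos-vertex 1+p<2h)
  ... | inj₂ 1+p≡2h = inj₂ (1+p≡2h , (begin
    pos (vertex (suc _))  ≡⟨ cong (pos ∘ vertex) 1+p≡2h ⟩
    pos (vertex (2 * h))  ≡⟨ cong pos (vertex-periodic 0) ⟩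
    pos (vertex 0)        ≡⟨ pos-vertex (≤-<-trans z≤n p<2h) ⟩
    0                     ∎))
    where open ≡-Reasoning

  module Arc (c : ℕ) (c+1<h : suc c < h) where

    InArc : ℕ → Set
    InArc p = c < p × p ≤ c + h

    inArc? : Decidable InArc
    inArc? p = (c <? p) ×-dec (p ≤? c + h)

    lowerOut lowerIn upperIn upperOut : Word k n
    lowerOut = vertex c
    lowerIn  = vertex (suc c)
    upperIn  = vertex (c + h)
    upperOut = vertex (suc (c + h))

    private
      c<c+h : c < c + h
      c<c+h = m<m+n c (≤-trans (s≤s z≤n) c+1<h)

      c+h+1<2h : suc (c + h) < 2 * h
      c+h+1<2h = +-mono-≤ c+1<h (≤-reflexive (sym (+-identityʳ h)))

      c+h<2h : c + h < 2 * h
      c+h<2h = <-trans (n<1+n _) c+h+1<2h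

    pos-lowerOut : pos lowerOut ≡ c
    pos-lowerOut = pos-vertex (<-trans c<c+h c+h<2h)

    pos-lowerIn : pos lowerIn ≡ suc c
    pos-lowerIn = pos-vertex (≤-<-trans c<c+h c+h<2h)

    pos-upperIn : pos upperIn ≡ c + h
    pos-upperIn = pos-vertex c+h<2h

    pos-upperOut : pos upperOut ≡ suc (c + h)
    pos-upperOut = pos-vertex c+h+1<2h

    leave-arc : InArc p → ¬ InArc (suc p) → p ≡ c + h
    leave-arc (c<p , p≤c+h) ¬in = ≤-antisym p≤c+h (≤-pred (≰⇒> (¬in ∘ (<-trans c<p (n<1+n _) ,_))))

    enter-arc : ¬ InArc p → InArc (suc p) → p ≡ c
    enter-arc ¬in (c<1+p , 1+p≤c+h) =
      ≤-antisym (≮⇒≥ (¬in ∘ (_, ≤-trans (n≤1+n _) 1+p≤c+h))) (≤-pred c<1+p)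

    ¬InArc-last : suc p ≡ 2 * h → ¬ InArc p
    ¬InArc-last 1+p≡2h (_ , p≤c+h) = <⇒≱ (≤-pred (subst (suc (c + h) <_) (sym 1+p≡2h) c+h+1<2h)) p≤c+h

    exit-arc : Adj E x y → InArc (pos x) → ¬ InArc (pos y) →
               (x ≡ upperIn × y ≡ upperOut) ⊎ (x ≡ lowerIn × y ≡ lowerOut)
    exit-arc {x} {y} x∼y in-x out-y with adj-pos x∼y
    ... | inj₁ pos-x≡pos-y = contradiction (subst InArc pos-x≡pos-y in-x) out-y
    ... | inj₂ (inj₁ (x≡ , y≡)) with pos-next (pos< x)
    ...   | inj₂ (last , _) = contradiction in-x (¬InArc-last last)
    ...   | inj₁ (_ , pos-y) with leave-arc in-x (out-y ∘ subst InArc (sym (trans (cong pos y≡) pos-y)))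
    ...     | pos-x≡ = inj₁ (trans x≡ (cong vertex pos-x≡) , trans y≡ (cong (vertex ∘ suc) pos-x≡))
    exit-arc {x} {y} x∼y in-x out-y | inj₂ (inj₂ (y≡ , x≡)) with pos-next (pos< y)
    ...   | inj₂ (_ , pos-x) = contradiction (subst InArc (trans (cong pos x≡) pos-x) in-x) λ ()
    ...   | inj₁ (_ , pos-x) with enter-arc out-y (subst InArc (trans (cong pos x≡) pos-x) in-x)
    ...     | pos-y≡ = inj₂ (trans x≡ (cong (vertex ∘ suc) pos-y≡) , trans y≡ (cong vertex pos-y≡))

    enter-arc-edge : Adj E x y → ∁ InArc (pos x) → ¬ ∁ InArc (pos y) →
                     (x ≡ upperOut × y ≡ upperIn) ⊎ (x ≡ lowerOut × y ≡ lowerIn)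
    enter-arc-edge x∼y out-x ¬out-y with exit-arc (Adj-sym x∼y) (decidable-stable (inArc? _) ¬out-y) out-x
    ... | inj₁ (y≡ , x≡) = inj₁ (x≡ , y≡)
    ... | inj₂ (y≡ , x≡) = inj₂ (x≡ , y≡)

    -- The distance along the cycle from p to the edge {c, c + 1}.
    Ψ : ℕ → ℕ
    Ψ p with p ≤? c | p ≤? c + h
    ... | yes _ | _     = c ∸ p
    ... | no _  | yes _ = p ∸ suc c
    ... | no _  | no _  = c + h + h ∸ p

    Ψ-below : p ≤ c → Ψ p ≡ c ∸ p
    Ψ-below {p} p≤c with p ≤? c
    ... | yes _   = refl
    ... | no p≰c = contradiction p≤c p≰c

    Ψ-inArc : InArc p → Ψ p ≡ p ∸ suc c
    Ψ-inArc {p} (c<p , p≤c+h) with p ≤? c | p ≤? c + h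
    ... | yes p≤c | _         = contradiction p≤c (<⇒≱ c<p)
    ... | no _    | yes _     = refl
    ... | no _    | no p≰c+h  = contradiction p≤c+h p≰c+h

    Ψ-above : c + h < p → Ψ p ≡ c + h + h ∸ p
    Ψ-above {p} c+h<p with p ≤? c | p ≤? c + h
    ... | yes p≤c | _        = contradiction (≤-trans p≤c (<⇒≤ c<c+h)) (<⇒≱ c+h<p)
    ... | no _    | yes p≤c+h = contradiction p≤c+h (<⇒≱ c+h<p)
    ... | no _    | no _     = refl

    Near : ℕ → ℕ → Set
    Near a b = a ≤ suc b × b ≤ suc a

    near-≡ : ∀ {a b} → a ≡ b → Near a b
    near-≡ refl = n≤1+n _ , n≤1+n _

    near-suc : ∀ {a b} → a ≡ suc b → Near a b
    near-suc refl = ≤-refl , m≤n⇒m≤1+n (n≤1+n _)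

    near-sym : ∀ {a b} → Near a b → Near b a
    near-sym (a≤1+b , b≤1+a) = b≤1+a , a≤1+b

    private
      inArc-lowerIn : InArc (suc c)
      inArc-lowerIn = n<1+n c , c<c+h

      inArc-upperIn : InArc (c + h)
      inArc-upperIn = c<c+h , ≤-refl

      2h≤c+h+h : 2 * h ≤ c + h + h
      2h≤c+h+h = ≤-trans (≤-reflexive (cong (h +_) (+-identityʳ h))) (+-monoˡ-≤ h (m≤n+m h c))

      c+h+h≡1+c+p : suc p ≡ 2 * h → c + h + h ≡ suc c + p
      c+h+h≡1+c+p {p} 1+p≡2h = begin
        c + h + h        ≡⟨ +-assoc c h h ⟩
        c + (h + h)      ≡⟨ cong (λ q → c + (h + q)) (sym (+-identityʳ h)) ⟩
        c + 2 * h        ≡⟨ cong (c +_) (sym 1+p≡2h) ⟩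
        c + suc p        ≡⟨ +-suc c p ⟩
        suc c + p        ∎
        where open ≡-Reasoning

    Ψ-lowerOut : Ψ c ≡ 0
    Ψ-lowerOut = trans (Ψ-below ≤-refl) (n∸n≡0 c)

    Ψ-lowerIn : Ψ (suc c) ≡ 0
    Ψ-lowerIn = trans (Ψ-inArc inArc-lowerIn) (n∸n≡0 c)

    Ψ-upperIn : Ψ (c + h) ≡ pred h
    Ψ-upperIn = begin
      Ψ (c + h)                ≡⟨ Ψ-inArc inArc-upperIn ⟩
      c + h ∸ suc c            ≡⟨ sym (pred[m∸n]≡m∸[1+n] (c + h) c) ⟩
      pred (c + h ∸ c)         ≡⟨ cong pred (m+n∸m≡n c h) ⟩
      pred h                   ∎
      where open ≡-Reasoning

    Ψ-upperOut : Ψ (suc (c + h)) ≡ pred h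
    Ψ-upperOut = begin
      Ψ (suc (c + h))              ≡⟨ Ψ-above (n<1+n _) ⟩
      c + h + h ∸ suc (c + h)      ≡⟨ sym (pred[m∸n]≡m∸[1+n] (c + h + h) (c + h)) ⟩
      pred (c + h + h ∸ (c + h))   ≡⟨ cong pred (m+n∸m≡n (c + h) h) ⟩
      pred h                       ∎
      where open ≡-Reasoning

    Ψ-step : suc p < 2 * h → Near (Ψ p) (Ψ (suc p))
    Ψ-step {p} 1+p<2h with <-cmp p c
    ... | tri< p<c _ _ =
      near-suc (trans (Ψ-below (<⇒≤ p<c)) (trans (+-∸-assoc 1 p<c) (cong suc (sym (Ψ-below p<c)))))
    ... | tri≈ _ refl _ = near-≡ (trans Ψ-lowerOut (sym Ψ-lowerIn))
    ... | tri> _ _ c<p with <-cmp p (c + h)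
    ...   | tri< p<c+h _ _ = near-sym (near-suc (trans (Ψ-inArc (<-trans c<p (n<1+n p) , p<c+h))
                                         (trans (+-∸-assoc 1 c<p) (cong suc (sym (Ψ-inArc (c<p , <⇒≤ p<c+h)))))))
    ...   | tri≈ _ refl _ = near-≡ (trans Ψ-upperIn (sym Ψ-upperOut))
    ...   | tri> _ _ c+h<p = near-suc (trans (Ψ-above c+h<p)
                               (trans (+-∸-assoc 1 (≤-trans (<⇒≤ 1+p<2h) 2h≤c+h+h))
                                      (cong suc (sym (Ψ-above (<-trans c+h<p (n<1+n p)))))))

    Ψ-wrap : suc p ≡ 2 * h → Near (Ψ p) (Ψ 0)
    Ψ-wrap {p} 1+p≡2h = near-suc (begin
      Ψ p                ≡⟨ Ψ-above (≤-pred (subst (suc (c + h) <_) (sym 1+p≡2h) c+h+1<2h)) ⟩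
      c + h + h ∸ p      ≡⟨ cong (_∸ p) (c+h+h≡1+c+p 1+p≡2h) ⟩
      suc c + p ∸ p      ≡⟨ m+n∸n≡m (suc c) p ⟩
      suc c              ≡⟨ cong suc (sym (Ψ-below z≤n)) ⟩
      suc (Ψ 0)          ∎)
      where open ≡-Reasoning

    Ψ-next : p < 2 * h → Near (Ψ p) (Ψ (pos (vertex (suc p))))
    Ψ-next {p} p<2h with pos-next p<2h
    ... | inj₁ (1+p<2h , pos≡) = subst (Near (Ψ p) ∘ Ψ) (sym pos≡) (Ψ-step 1+p<2h)
    ... | inj₂ (1+p≡2h , pos≡) = subst (Near (Ψ p) ∘ Ψ) (sym pos≡) (Ψ-wrap 1+p≡2h)

    Ψ-adj : Adj E x y → Ψ (pos x) ≤ suc (Ψ (pos y))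
    Ψ-adj {x} {y} x∼y with adj-pos x∼y
    ... | inj₁ pos-x≡pos-y      = ≤-trans (≤-reflexive (cong Ψ pos-x≡pos-y)) (n≤1+n _)
    ... | inj₂ (inj₁ (_ , y≡)) = proj₁ (subst (Near (Ψ (pos x)) ∘ Ψ ∘ pos) (sym y≡) (Ψ-next (pos< x)))
    ... | inj₂ (inj₂ (_ , x≡)) = proj₂ (subst (Near (Ψ (pos y)) ∘ Ψ ∘ pos) (sym x≡) (Ψ-next (pos< y)))

    far-apart : Walk≤ E m x y → Ψ (pos x) ≡ pred h → Ψ (pos y) ≡ 0 → pred h ≤ m
    far-apart {m} x→y Ψx Ψy =
      subst₂ _≤_ Ψx (trans (cong (m +_) Ψy) (+-identityʳ m)) (walk-potential (Ψ ∘ pos) Ψ-adj x→y)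

    private
      instance
        h-nonZero : NonZero h
        h-nonZero = >-nonZero (<-trans (s≤s z≤n) c+1<h)

    lowerIn→upperIn : Walk≤ E (pred h) lowerIn upperIn
    lowerIn→upperIn = subst (Walk≤ E (pred h) lowerIn ∘ vertex) pred-h+1+c≡c+h (walk-along (pred h) (suc c))
      where
      pred-h+1+c≡c+h : pred h + suc c ≡ c + h
      pred-h+1+c≡c+h = trans (+-suc (pred h) c) (trans (cong (_+ c) (suc-pred h)) (+-comm h c))

    upperOut→lowerOut : Walk≤ E (pred h) upperOut lowerOut
    upperOut→lowerOut = subst (Walk≤ E (pred h) upperOut) (trans (cong vertex pred-h+1+c+h≡c+2h) (vertex-periodic c))
                              (walk-along (pred h) (suc (c + h)))
      where
      pred-h+1+c+h≡c+2h : pred h + suc (c + h) ≡ c + 2 * h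
      pred-h+1+c+h≡c+2h = begin
        pred h + suc (c + h)   ≡⟨ +-suc (pred h) (c + h) ⟩
        suc (pred h) + (c + h) ≡⟨ cong (_+ (c + h)) (suc-pred h) ⟩
        h + (c + h)            ≡⟨ rearrange h c ⟩
        c + 2 * h              ∎
        where
        open ≡-Reasoning
        rearrange : ∀ a b → a + (b + a) ≡ b + 2 * a
        rearrange = solve-∀

    Inside : Word k n → Set
    Inside z = InArc (pos z)

    inside? : Decidable Inside
    inside? z = inArc? (pos z)

    private
      inside-upperIn : Inside upperIn
      inside-upperIn = subst InArc (sym pos-upperIn) inArc-upperIn

      inside-lowerIn : Inside lowerIn
      inside-lowerIn = subst InArc (sym pos-lowerIn) inArc-lowerIn

      outside-upperOut : ¬ Inside upperOut
      outside-upperOut (_ , c+h+1≤c+h) = <⇒≱ (n<1+n (c + h)) (subst (_≤ c + h) pos-upperOut c+h+1≤c+h)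

      outside-lowerOut : ¬ Inside lowerOut
      outside-lowerOut (c<c , _) = <⇒≱ (subst (c <_) pos-lowerOut c<c) ≤-refl

      far-upper-lower : Walk≤ E m x y → x ≡ upperIn ⊎ x ≡ upperOut → y ≡ lowerIn ⊎ y ≡ lowerOut →
                        pred h ≤ m
      far-upper-lower x→y x-upper y-lower = far-apart x→y (Ψ-upper x-upper) (Ψ-lower y-lower)
        where
        Ψ-upper : x ≡ upperIn ⊎ x ≡ upperOut → Ψ (pos x) ≡ pred h
        Ψ-upper (inj₁ refl) = trans (cong Ψ pos-upperIn) Ψ-upperIn
        Ψ-upper (inj₂ refl) = trans (cong Ψ pos-upperOut) Ψ-upperOut
        Ψ-lower : y ≡ lowerIn ⊎ y ≡ lowerOut → Ψ (pos y) ≡ 0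
        Ψ-lower (inj₁ refl) = trans (cong Ψ pos-lowerIn) Ψ-lowerIn
        Ψ-lower (inj₂ refl) = trans (cong Ψ pos-lowerOut) Ψ-lowerOut

    to-upperIn : Shortcut Inside upperOut upperIn
    to-upperIn = shortcut-through-gates inside? exit-arc outside-upperOut lowerIn→upperIn
      (λ lowerOut→upperOut → far-upper-lower (walk-reverse lowerOut→upperOut) (inj₂ refl) (inj₂ refl))

    to-upperOut : Shortcut (∁ Inside) upperIn upperOut
    to-upperOut = shortcut-through-gates (∁? inside?) enter-arc-edge (λ out → out inside-upperIn)
      (walk-reverse upperOut→lowerOut)
      (λ lowerIn→upperIn′ → far-upper-lower (walk-reverse lowerIn→upperIn′) (inj₁ refl) (inj₁ refl))

    to-lowerIn : Shortcut Inside lowerOut lowerIn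
    to-lowerIn = shortcut-through-gates inside? (λ x∼y in-x out-y → swap (exit-arc x∼y in-x out-y))
      outside-lowerOut (walk-reverse lowerIn→upperIn)
      (λ upperOut→lowerOut′ → far-upper-lower upperOut→lowerOut′ (inj₂ refl) (inj₂ refl))

    to-lowerOut : Shortcut (∁ Inside) lowerIn lowerOut
    to-lowerOut = shortcut-through-gates (∁? inside?) (λ x∼y out-x in-y → swap (enter-arc-edge x∼y out-x in-y))
      (λ out → out inside-lowerIn) upperOut→lowerOut
      (λ upperIn→lowerIn → far-upper-lower upperIn→lowerIn (inj₁ refl) (inj₁ refl))

    closer-upper : ∀ z → (Closer E upperIn upperOut z ⇔ Inside z) × (Closer E upperOut upperIn z ⇔ ∁ Inside z)
    closer-upper = closer⇔ connected inside? to-upperIn to-upperOut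

    closer-lower : ∀ z → (Closer E lowerIn lowerOut z ⇔ Inside z) × (Closer E lowerOut lowerIn z ⇔ ∁ Inside z)
    closer-lower = closer⇔ connected inside? to-lowerIn to-lowerOut

-- Trees

NonLoop : ∀ {k} → OEdge k → Set
NonLoop (a , b) = a ≢ b

nonLoop? : ∀ {k} → Decidable (NonLoop {k})
nonLoop? (a , b) = ¬? (a ≟ᶠ b)

module _ {k : ℕ} where

  private
    variable
      E : List (OEdge k)
      a b c : Fin k

  reach-++ : Reachable E a b → Reachable E b c → Reachable E a c
  reach-++ refl      r′ = r′
  reach-++ (fwd e r) r′ = fwd e (reach-++ r r′)
  reach-++ (bwd e r) r′ = bwd e (reach-++ r r′)

  reach-sym : Reachable E a b → Reachable E b a
  reach-sym refl      = refl
  reach-sym (fwd e r) = reach-++ (reach-sym r) (bwd e refl)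
  reach-sym (bwd e r) = reach-++ (reach-sym r) (fwd e refl)

  nonloop-edge : Reachable E a b → a ≢ b → ∃[ f ] f ∈ E × NonLoop f
  nonloop-edge refl a≢b = contradiction refl a≢b
  nonloop-edge {a = a} (fwd {b = c} e r) a≢b with a ≟ᶠ c
  ... | yes refl = nonloop-edge r a≢b
  ... | no a≢c   = (a , c) , e , a≢c
  nonloop-edge {a = a} (bwd {b = c} e r) a≢b with c ≟ᶠ a
  ... | yes refl = nonloop-edge r a≢b
  ... | no c≢a   = (c , a) , e , c≢a

  reach-filter : {P : OEdge k → Set} (P? : Decidable P) →
    (∀ {a b} → (a , b) ∈ E → ¬ P (a , b) → Reachable (filter P? E) a b) →
    Reachable E a b → Reachable (filter P? E) a b
  reach-filter P? bridge refl = refl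
  reach-filter P? bridge (fwd {a} {b} e r) with P? (a , b)
  ... | yes Pab = fwd (∈-filter⁺ P? e Pab) (reach-filter P? bridge r)
  ... | no ¬Pab = reach-++ (bridge e ¬Pab) (reach-filter P? bridge r)
  reach-filter P? bridge (bwd {a} {b} e r) with P? (b , a)
  ... | yes Pba = bwd (∈-filter⁺ P? e Pba) (reach-filter P? bridge r)
  ... | no ¬Pba = reach-++ (reach-sym (bridge e ¬Pba)) (reach-filter P? bridge r)

reach-map : ∀ {k l} {E : List (OEdge k)} (g : Fin k → Fin l) {a b} → Reachable E a b →
  Reachable (map (λ (p , q) → g p , g q) E) (g a) (g b)
reach-map g refl      = refl
reach-map g (fwd e r) = fwd (∈-map⁺ _ e) (reach-map g r)
reach-map g (bwd e r) = bwd (∈-map⁺ _ e) (reach-map g r)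

edge-contraction : ∀ {k} (E : List (OEdge (suc (suc k)))) → (∀ a b → Reachable E a b) →
  ∃[ E′ ] (∀ a b → Reachable E′ a b) × length E′ < length E
edge-contraction {k} E connected
  with (p , q) , pq∈E , p≢q ← nonloop-edge (connected zero (suc zero)) (λ ())
  = E′ , connected′ , fewer-edges
  where
  -- Merges q into p, so that the edge (p , q) becomes a loop and is dropped.
  merge : Fin (suc (suc k)) → Fin (suc k)
  merge x with x ≟ᶠ q
  ... | yes _   = punchOut (p≢q ∘ sym)
  ... | no x≢q = punchOut (x≢q ∘ sym)

  merged = map (λ (a , b) → merge a , merge b) E
  E′ = filter nonLoop? merged

  merge-punchIn : ∀ a → merge (punchIn q a) ≡ a
  merge-punchIn a with punchIn q a ≟ᶠ q
  ... | yes eq = contradiction eq (punchInᵢ≢i q a)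
  ... | no _   = trans (punchOut-cong q refl) (punchOut-punchIn q)

  merge-p≡merge-q : merge p ≡ merge q
  merge-p≡merge-q with p ≟ᶠ q | q ≟ᶠ q
  ... | yes p≡q | _       = contradiction p≡q p≢q
  ... | no _    | yes _   = punchOut-cong q refl
  ... | no _    | no q≢q = contradiction refl q≢q

  loop-reach : ∀ {a b} → (a , b) ∈ merged → ¬ NonLoop (a , b) → Reachable E′ a b
  loop-reach {a} {b} _ ¬a≢b = subst (Reachable E′ a) (decidable-stable (a ≟ᶠ b) ¬a≢b) refl

  connected′ : ∀ a b → Reachable E′ a b
  connected′ a b = subst₂ (Reachable E′) (merge-punchIn a) (merge-punchIn b)
    (reach-filter nonLoop? loop-reach (reach-map merge (connected (punchIn q a) (punchIn q b))))

  fewer-edges : length E′ < length E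
  fewer-edges = subst (length E′ <_) (length-map _ E)
    (filter-notAll nonLoop? merged (lose (∈-map⁺ _ pq∈E) (λ merged-nonloop → merged-nonloop merge-p≡merge-q)))

connected⇒k≤1+edges : ∀ k (E : List (OEdge k)) → (∀ a b → Reachable E a b) → k ≤ suc (length E)
connected⇒k≤1+edges zero          E connected = z≤n
connected⇒k≤1+edges (suc zero)    E connected = s≤s z≤n
connected⇒k≤1+edges (suc (suc k)) E connected =
  let (E′ , connected′ , fewer-edges) = edge-contraction E connected in
  ≤-trans (s≤s (connected⇒k≤1+edges (suc k) E′ connected′)) (s≤s fewer-edges)

_≟ₑ_ : ∀ {k} → Binary.DecidableEquality (OEdge k)
_≟ₑ_ = ≡-dec× _≟ᶠ_ _≟ᶠ_

module TreeSides {k : ℕ} {E : List (OEdge k)} (tree : IsTree k E) {s t : Fin k} (st∈E : (s , t) ∈ E) where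

  NotST : OEdge k → Set
  NotST f = f ≢ (s , t)

  notST? : Decidable NotST
  notST? f = ¬? (f ≟ₑ (s , t))

  E∖st : List (OEdge k)
  E∖st = filter notST? E

  s≁t : ¬ Reachable E∖st s t
  s≁t s~t = <⇒≱ (≤-<-trans fewer-edges (subst (length E <_) (proj₁ tree) (m<m+n _ (s≤s z≤n))))
                (connected⇒k≤1+edges k E∖st connected∖st)
    where
    fewer-edges : suc (length E∖st) ≤ length E
    fewer-edges = filter-notAll notST? E (lose st∈E λ st≢st → st≢st refl)
    bridge : ∀ {a b} → (a , b) ∈ E → ¬ NotST (a , b) → Reachable E∖st a b
    bridge {a} {b} _ ¬ab≢st with refl ← decidable-stable ((a , b) ≟ₑ (s , t)) ¬ab≢st = s~t
    connected∖st : ∀ a b → Reachable E∖st a b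
    connected∖st a b = reach-filter notST? bridge (proj₂ tree a b)

  private
    towards-st : ∀ {a b} → Reachable E a b → Reachable E∖st b s ⊎ Reachable E∖st b t →
                 Reachable E∖st a s ⊎ Reachable E∖st a t
    towards-st refl r = r
    towards-st (fwd {a} {b} e r) r′ with notST? (a , b)
    ... | yes ab≢st = let e′ = ∈-filter⁺ notST? e ab≢st in map⊎ (fwd e′) (fwd e′) (towards-st r r′)
    ... | no ¬ab≢st with refl ← decidable-stable ((a , b) ≟ₑ (s , t)) ¬ab≢st = inj₁ refl
    towards-st (bwd {a} {b} e r) r′ with notST? (b , a)
    ... | yes ba≢st = let e′ = ∈-filter⁺ notST? e ba≢st in map⊎ (bwd e′) (bwd e′) (towards-st r r′)
    ... | no ¬ba≢st with refl ← decidable-stable ((b , a) ≟ₑ (s , t)) ¬ba≢st = inj₂ refl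

  component : ∀ c → Reachable E∖st c s ⊎ Reachable E∖st c t
  component c = towards-st (proj₂ tree c s) (inj₁ refl)

  side : Fin k → Bool
  side c = [ (λ _ → false) , (λ _ → true) ]′ (component c)

  side-s : side s ≡ false
  side-s with component s
  ... | inj₁ _   = refl
  ... | inj₂ s~t = contradiction s~t s≁t

  side-t : side t ≡ true
  side-t with component t
  ... | inj₁ t~s = contradiction (reach-sym t~s) s≁t
  ... | inj₂ _   = refl

  side-edge : ∀ {p q} → (p , q) ∈ E → NotST (p , q) → side p ≡ side q
  side-edge {p} {q} pq∈E pq≢st with component p | component q
  ... | inj₁ _   | inj₁ _   = refl
  ... | inj₂ _   | inj₂ _   = refl
  ... | inj₁ p~s | inj₂ q~t = contradiction (reach-++ (reach-sym p~s) (fwd pq∈E∖st q~t)) s≁t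
    where pq∈E∖st = ∈-filter⁺ notST? pq∈E pq≢st
  ... | inj₂ p~t | inj₁ q~s = contradiction (reach-++ (reach-sym q~s) (bwd pq∈E∖st p~t)) s≁t
    where pq∈E∖st = ∈-filter⁺ notST? pq∈E pq≢st

-- The binary odometer and the action of an edge

inc : ∀ {m} → Vec Bool m → Vec Bool m
inc []          = []
inc (false ∷ b) = true ∷ inc b
inc (true ∷ b)  = false ∷ b

-- Binary, least significant digit first, with false as the digit 1: under false ↦ s, true ↦ t the
-- odometer inc is act (s , t) (act-stWord), so value numbers the e-cycle of w consecutively.
value : ∀ {m} → Vec Bool m → ℕ
value []          = 0
value (false ∷ b) = suc (2 * value b)
value (true ∷ b)  = 2 * value b

1+2a<2n : ∀ {a n} → a < n → suc (2 * a) < 2 * n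
1+2a<2n {a} a<n = ≤-trans (≤-reflexive (sym (*-suc 2 a))) (*-monoʳ-≤ 2 a<n)

value< : ∀ {m} (b : Vec Bool m) → value b < 2 ^ m
value< []          = s≤s z≤n
value< (false ∷ b) = 1+2a<2n (value< b)
value< (true ∷ b)  = <-trans (n<1+n _) (1+2a<2n (value< b))

value-injective : ∀ {m} {b b′ : Vec Bool m} → value b ≡ value b′ → b ≡ b′
value-injective {b = []}        {[]}         _  = refl
value-injective {b = false ∷ b} {false ∷ b′} eq =
  cong (false ∷_) (value-injective (*-cancelˡ-≡ (value b) (value b′) 2 (suc-injective eq)))
value-injective {b = true ∷ b}  {true ∷ b′}  eq =
  cong (true ∷_) (value-injective (*-cancelˡ-≡ (value b) (value b′) 2 eq))
value-injective {b = false ∷ b} {true ∷ b′}  eq = contradiction (sym eq) (even≢odd (value b′) (value b))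
value-injective {b = true ∷ b}  {false ∷ b′} eq = contradiction eq (even≢odd (value b) (value b′))

value-inc : ∀ {m} (b : Vec Bool m) → suc (value b) < 2 ^ m → value (inc b) ≡ suc (value b)
value-inc []          (s≤s ())
value-inc {suc m} (false ∷ b) 2+2v<2^m = begin
  2 * value (inc b)        ≡⟨ cong (2 *_) (value-inc b 1+v<2^m) ⟩
  2 * suc (value b)        ≡⟨ *-suc 2 (value b) ⟩
  suc (suc (2 * value b))  ∎
  where
  open ≡-Reasoning
  1+v<2^m : suc (value b) < 2 ^ m
  1+v<2^m = *-cancelˡ-< 2 (suc (value b)) (2 ^ m) (subst (_< 2 * 2 ^ m) (sym (*-suc 2 (value b))) 2+2v<2^m)
value-inc (true ∷ b)  _ = refl

inc-last : ∀ {m} (b : Vec Bool m) → suc (value b) ≡ 2 ^ m → inc b ≡ replicate m true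
inc-last []          _  = refl
inc-last (false ∷ b) eq =
  cong (true ∷_) (inc-last b (*-cancelˡ-≡ (suc (value b)) _ 2 (trans (*-suc 2 (value b)) eq)))
inc-last {suc m} (true ∷ b) eq = contradiction (sym eq) (even≢odd (2 ^ m) (value b))

bits : ∀ m → ℕ → Vec Bool m
bits m zero    = replicate m true
bits m (suc p) = inc (bits m p)

value-replicate-true : ∀ m → value (replicate m true) ≡ 0
value-replicate-true zero    = refl
value-replicate-true (suc m) = cong (2 *_) (value-replicate-true m)

1+value-replicate-false : ∀ m → suc (value (replicate m false)) ≡ 2 ^ m
1+value-replicate-false zero    = refl
1+value-replicate-false (suc m) =
  trans (sym (*-suc 2 (value (replicate m false)))) (cong (2 *_) (1+value-replicate-false m))

value-bits : ∀ {m p} → p < 2 ^ m → value (bits m p) ≡ p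
value-bits {m} {zero}  _      = value-replicate-true m
value-bits {m} {suc p} 1+p<2^m = begin
  value (inc (bits m p))    ≡⟨ value-inc (bits m p) (subst (λ v → suc v < 2 ^ m) (sym IH) 1+p<2^m) ⟩
  suc (value (bits m p))    ≡⟨ cong suc IH ⟩
  suc p                     ∎
  where
  open ≡-Reasoning
  IH = value-bits {m} {p} (<-trans (n<1+n p) 1+p<2^m)

bits-value : ∀ {m} (b : Vec Bool m) → bits m (value b) ≡ b
bits-value b = value-injective (value-bits (value< b))

bits-periodic : ∀ m p → bits m (p + 2 ^ m) ≡ bits m p
bits-periodic m zero = begin
  bits m (2 ^ m)                      ≡⟨ cong (bits m) (sym (suc-pred (2 ^ m))) ⟩
  inc (bits m (pred (2 ^ m)))         ≡⟨ inc-last _ (trans (cong suc (value-bits pred<)) (suc-pred (2 ^ m))) ⟩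
  replicate m true                    ∎
  where
  open ≡-Reasoning
  instance _ = m^n≢0 2 m
  pred< : pred (2 ^ m) < 2 ^ m
  pred< = ≤-reflexive (suc-pred (2 ^ m))
bits-periodic m (suc p) = cong inc (bits-periodic m p)

value-∷ʳ-true : ∀ {m} (b : Vec Bool m) → value (b ∷ʳ true) ≡ value b
value-∷ʳ-true []          = refl
value-∷ʳ-true (false ∷ b) = cong (λ v → suc (2 * v)) (value-∷ʳ-true b)
value-∷ʳ-true (true ∷ b)  = cong (2 *_) (value-∷ʳ-true b)

value-∷ʳ-false : ∀ {m} (b : Vec Bool m) → value (b ∷ʳ false) ≡ value b + 2 ^ m
value-∷ʳ-false []          = refl
value-∷ʳ-false {suc m} (false ∷ b) =
  cong suc (trans (cong (2 *_) (value-∷ʳ-false b)) (*-distribˡ-+ 2 (value b) (2 ^ m)))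
value-∷ʳ-false {suc m} (true ∷ b)  =
  trans (cong (2 *_) (value-∷ʳ-false b)) (*-distribˡ-+ 2 (value b) (2 ^ m))

module _ {k : ℕ} (p q : Fin k) where

  act-p∷ : ∀ {n} (y : Word k n) → act (p , q) (p ∷ y) ≡ q ∷ act (p , q) y
  act-p∷ y with p ≟ᶠ p
  ... | yes _   = refl
  ... | no p≢p = contradiction refl p≢p

  act-q∷ : ∀ {n} (y : Word k n) → p ≢ q → act (p , q) (q ∷ y) ≡ p ∷ y
  act-q∷ y p≢q with q ≟ᶠ p | q ≟ᶠ q
  ... | yes q≡p | _       = contradiction (sym q≡p) p≢q
  ... | no _    | yes _   = refl
  ... | no _    | no q≢q = contradiction refl q≢q

  act-other∷ : ∀ {n c} (y : Word k n) → c ≢ p → c ≢ q → act (p , q) (c ∷ y) ≡ c ∷ y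
  act-other∷ {c = c} y c≢p c≢q with c ≟ᶠ p | c ≟ᶠ q
  ... | yes c≡p | _       = contradiction c≡p c≢p
  ... | no _    | yes c≡q = contradiction c≡q c≢q
  ... | no _    | no _    = refl

  act-replicate : ∀ m → act (p , q) (replicate m p) ≡ replicate m q
  act-replicate zero    = refl
  act-replicate (suc m) = trans (act-p∷ (replicate m p)) (cong (q ∷_) (act-replicate m))

  act-++ : ∀ {m j} (y : Word k m) (r : Word k j) →
    act (p , q) (y ++ r) ≡ act (p , q) y ++ r
    ⊎ (y ≡ replicate m p × act (p , q) (y ++ r) ≡ act (p , q) y ++ act (p , q) r)
  act-++ []      r = inj₂ (refl , refl)
  act-++ (c ∷ y) r with c ≟ᶠ p | c ≟ᶠ q
  ... | no _    | yes _ = inj₁ refl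
  ... | no _    | no _  = inj₁ refl
  ... | yes refl | _ with act-++ y r
  ...   | inj₁ eq          = inj₁ (cong (q ∷_) eq)
  ...   | inj₂ (y≡ , eq)   = inj₂ (cong (p ∷_) y≡ , cong (q ∷_) eq)

act-stWord : ∀ {k m} {s t : Fin k} → s ≢ t → (b : Vec Bool m) →
  act (s , t) (stWord s t b) ≡ stWord s t (inc b)
act-stWord s≢t []          = refl
act-stWord {s = s} {t} s≢t (false ∷ b) = trans (act-p∷ s t (stWord s t b)) (cong (t ∷_) (act-stWord s≢t b))
act-stWord {s = s} {t} s≢t (true ∷ b)  = act-q∷ s t (stWord s t b) s≢t

act-FirstNotIn : ∀ {k j} {s t : Fin k} (r : Word k j) → FirstNotIn s t r → act (s , t) r ≡ r
act-FirstNotIn []      _             = refl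
act-FirstNotIn (c ∷ r) (c≢s , c≢t) = act-other∷ _ _ r c≢s c≢t

act-to-FirstNotIn : ∀ {k j} {s t : Fin k} (r : Word k j) → FirstNotIn s t (act (s , t) r) → act (s , t) r ≡ r
act-to-FirstNotIn []      _ = refl
act-to-FirstNotIn {s = s} {t} (c ∷ r) first with c ≟ᶠ s | c ≟ᶠ t
... | yes _ | _     = contradiction refl (proj₂ first)
... | no _  | yes _ = contradiction refl (proj₁ first)
... | no _  | no _  = refl

data Letter {k : ℕ} (s t : Fin k) : Fin k → Set where
  is-s     : Letter s t s
  is-t     : Letter s t t
  is-other : ∀ {c} → c ≢ s → c ≢ t → Letter s t c

letter : ∀ {k} (s t c : Fin k) → Letter s t c
letter s t c with c ≟ᶠ s | c ≟ᶠ t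
... | yes refl | _        = is-s
... | no _     | yes refl = is-t
... | no c≢s   | no c≢t   = is-other c≢s c≢t

module _ {k : ℕ} {E : List (OEdge k)} where

  adj-∷ : ∀ {n} {x y : Word k n} → Adj E x y → ∃₂ λ c d → Adj E (c ∷ x) (d ∷ y)
  adj-∷ {x = x} ((p , q) , pq∈E , inj₁ refl) = p , q , (p , q) , pq∈E , inj₁ (act-p∷ p q x)
  adj-∷ {y = y} ((p , q) , pq∈E , inj₂ refl) = q , p , (p , q) , pq∈E , inj₂ (act-p∷ p q y)

  move-head : ∀ {n a b} → Reachable E a b → (x : Word k n) → ∃[ m ] Walk≤ E m (a ∷ x) (b ∷ x)
  move-head refl x = 0 , stop
  move-head {a = a} (fwd {b = c} ac∈E r) x with a ≟ᶠ c
  ... | yes refl = move-head r x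
  ... | no a≢c   = let (m , walk) = move-head r x in suc m , step (_ , ac∈E , inj₂ (act-q∷ a c x a≢c)) walk
  move-head {a = a} (bwd {b = c} ca∈E r) x with c ≟ᶠ a
  ... | yes refl = move-head r x
  ... | no c≢a   = let (m , walk) = move-head r x in suc m , step (_ , ca∈E , inj₁ (act-q∷ c a x c≢a)) walk

  module _ (connected : ∀ a b → Reachable E a b) where

    walk-∷ : ∀ {n m} {x y : Word k n} → Walk≤ E m x y → ∀ a b → ∃[ m′ ] Walk≤ E m′ (a ∷ x) (b ∷ y)
    walk-∷ {x = x} stop a b = move-head (connected a b) x
    walk-∷ {x = x} (step x∼x′ walk) a b =
      let (c , d , cx∼dx′) = adj-∷ x∼x′
          (m₁ , a→c) = move-head (connected a c) x
          (m₂ , dx′→by) = walk-∷ walk d b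
      in m₁ + suc m₂ , Walks.walk-++ E a→c (step cx∼dx′ dx′→by)

    Γ-connected : ∀ {n} (x y : Word k n) → ∃[ m ] Walk≤ E m x y
    Γ-connected []      []      = 0 , stop
    Γ-connected (a ∷ x) (b ∷ y) = walk-∷ (proj₂ (Γ-connected x y)) a b

-- Position on the e-cycle

module Shadow {k : ℕ} {s t : Fin k} (side : Fin k → Bool) (side-s : side s ≡ false) (side-t : side t ≡ true) where

  private
    variable
      m : ℕ
      c : Fin k
      y : Word k m

  ownSide : Fin k → Maybe Bool
  ownSide c with c ≟ᶠ s | c ≟ᶠ t
  ... | no _ | no _ = just (side c)
  ... | _    | _    = nothing

  ownSide-st : c ≡ s ⊎ c ≡ t → ownSide c ≡ nothing
  ownSide-st {c} c∈st with c ≟ᶠ s | c ≟ᶠ t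
  ... | yes _   | _       = refl
  ... | no _    | yes _   = refl
  ... | no c≢s | no c≢t = contradiction c∈st [ c≢s , c≢t ]′

  ownSide-other : c ≢ s → c ≢ t → ownSide c ≡ just (side c)
  ownSide-other {c} c≢s c≢t with c ≟ᶠ s | c ≟ᶠ t
  ... | yes c≡s | _       = contradiction c≡s c≢s
  ... | no _    | yes c≡t = contradiction c≡t c≢t
  ... | no _    | no _    = refl

  ownSide-nothing : ownSide c ≡ nothing → c ≡ s ⊎ c ≡ t
  ownSide-nothing {c} eq with c ≟ᶠ s | c ≟ᶠ t
  ... | yes c≡s | _       = inj₁ c≡s
  ... | no _    | yes c≡t = inj₂ c≡t
  ... | no _    | no _    with () ← eq

  anchor : Word k m → Maybe Bool
  anchor []      = nothing
  anchor (c ∷ y) = anchor y <∣> ownSide c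

  lead : Bool → Word k m → Bool
  lead d y = fromMaybe d (anchor y)

  shadow : Word k m → Vec Bool m
  shadow []      = []
  shadow (c ∷ y) = lead (side c) y ∷ shadow y

  s≢t : s ≢ t
  s≢t s≡t with () ← trans (sym side-s) (trans (cong side s≡t) side-t)

  anchor-st∷ : c ≡ s ⊎ c ≡ t → anchor (c ∷ y) ≡ anchor y
  anchor-st∷ {y = y} c∈st = trans (cong (anchor y <∣>_) (ownSide-st c∈st)) (<∣>-identityʳ (anchor y))

  lead-∷ : ∀ {d} → side c ≡ d → lead d (c ∷ y) ≡ lead d y
  lead-∷ {c} {y = y} {d} side-c≡d with anchor y | c ≟ᶠ s | c ≟ᶠ t
  ... | just _  | _     | _     = refl
  ... | nothing | yes _ | _     = refl
  ... | nothing | no _  | yes _ = refl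
  ... | nothing | no _  | no _  = side-c≡d

  shadow-act : ∀ {p q} → side p ≡ side q → (y : Word k m) →
    shadow (act (p , q) y) ≡ shadow y × lead (side p) (act (p , q) y) ≡ lead (side p) y
  shadow-act             sides []      = refl , refl
  shadow-act {p = p} {q} sides (c ∷ y) with c ≟ᶠ p | c ≟ᶠ q
  ... | yes refl | _ =
    let (shadow≡ , lead≡) = shadow-act sides y in
    cong₂ _∷_ (trans (cong (λ d → lead d (act (p , q) y)) (sym sides)) lead≡) shadow≡ ,
    trans (lead-∷ {y = act (p , q) y} (sym sides)) (trans lead≡ (sym (lead-∷ {y = y} refl)))
  ... | no _ | yes refl = cong (_∷ shadow y) (cong (λ d → lead d y) sides) ,
                          trans (lead-∷ {y = y} refl) (sym (lead-∷ {y = y} (sym sides)))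
  ... | no _ | no _     = refl , refl

  shadow-act-st : ∀ {σ} (y : Word k m) → anchor y ≡ just σ →
    shadow (act (s , t) y) ≡ shadow y × anchor (act (s , t) y) ≡ just σ
  shadow-act-st (c ∷ y) anchor≡ with letter s t c
  ... | is-s rewrite act-p∷ s t y =
    let anchor-y = trans (sym (anchor-st∷ {y = y} (inj₁ refl))) anchor≡
        (shadow≡ , anchor-act≡) = shadow-act-st y anchor-y in
    cong₂ _∷_ (trans (cong (fromMaybe (side t)) anchor-act≡) (sym (cong (fromMaybe (side s)) anchor-y))) shadow≡ ,
    trans (anchor-st∷ {y = act (s , t) y} (inj₂ refl)) anchor-act≡
  ... | is-t rewrite act-q∷ s t y s≢t =
    let anchor-y = trans (sym (anchor-st∷ {y = y} (inj₂ refl))) anchor≡ in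
    cong (_∷ shadow y) (trans (cong (fromMaybe (side s)) anchor-y) (sym (cong (fromMaybe (side t)) anchor-y))) ,
    trans (anchor-st∷ {y = y} (inj₁ refl)) anchor-y
  ... | is-other c≢s c≢t rewrite act-other∷ s t y c≢s c≢t = refl , anchor≡

  anchor-nothing : (y : Word k m) → anchor y ≡ nothing → y ≡ stWord s t (shadow y)
  anchor-nothing []      _       = refl
  anchor-nothing (c ∷ y) anchor≡ with anchor y in anchor-y
  ... | nothing = cong₂ _∷_ (st-letter (ownSide-nothing anchor≡)) (anchor-nothing y anchor-y)
    where
    st-letter : c ≡ s ⊎ c ≡ t → c ≡ (if side c then t else s)
    st-letter (inj₁ refl) = cong (λ b → if b then t else s) (sym side-s)
    st-letter (inj₂ refl) = cong (λ b → if b then t else s) (sym side-t)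

  shadow-stWord : (b : Vec Bool m) → shadow (stWord s t b) ≡ b × anchor (stWord s t b) ≡ nothing
  shadow-stWord []          = refl , refl
  shadow-stWord (false ∷ b) with shadow-stWord b
  ... | shadow≡ , anchor≡ = cong₂ _∷_ (trans (cong (fromMaybe (side s)) anchor≡) side-s) shadow≡ ,
                            trans (anchor-st∷ {y = stWord s t b} (inj₁ refl)) anchor≡
  shadow-stWord (true ∷ b) with shadow-stWord b
  ... | shadow≡ , anchor≡ = cong₂ _∷_ (trans (cong (fromMaybe (side t)) anchor≡) side-t) shadow≡ ,
                            trans (anchor-st∷ {y = stWord s t b} (inj₂ refl)) anchor≡

  shadow-replicate : ∀ m c → shadow (replicate m c) ≡ replicate m (side c)
  shadow-replicate zero    c = refl
  shadow-replicate (suc m) c = cong₂ _∷_ (lead-replicate m) (shadow-replicate m c)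
    where
    lead-replicate : ∀ m → lead (side c) (replicate m c) ≡ side c
    lead-replicate zero    = refl
    lead-replicate (suc m) = trans (lead-∷ {y = replicate m c} refl) (lead-replicate m)

  shadow-∷ʳ-st : (y : Word k m) → c ≡ s ⊎ c ≡ t → shadow (y ∷ʳ c) ≡ shadow y ∷ʳ side c
  shadow-∷ʳ-st []      c∈st = refl
  shadow-∷ʳ-st {c = c} (d ∷ y) c∈st =
    cong₂ _∷_ (cong (fromMaybe (side d)) (anchor-∷ʳ y)) (shadow-∷ʳ-st y c∈st)
    where
    anchor-∷ʳ : ∀ {m} (y : Word k m) → anchor (y ∷ʳ c) ≡ anchor y
    anchor-∷ʳ []      = ownSide-st c∈st
    anchor-∷ʳ (d ∷ y) = cong (_<∣> ownSide d) (anchor-∷ʳ y)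

  shadow-∷ʳ-other : (y : Word k m) → c ≢ s → c ≢ t → shadow (y ∷ʳ c) ≡ replicate (suc m) (side c)
  shadow-∷ʳ-other []      c≢s c≢t = refl
  shadow-∷ʳ-other {c = c} (d ∷ y) c≢s c≢t =
    cong₂ _∷_ (cong (fromMaybe (side d)) (anchor-∷ʳ y)) (shadow-∷ʳ-other y c≢s c≢t)
    where
    anchor-∷ʳ : ∀ {m} (y : Word k m) → anchor (y ∷ʳ c) ≡ just (side c)
    anchor-∷ʳ []      = ownSide-other c≢s c≢t
    anchor-∷ʳ (d ∷ y) = cong (_<∣> ownSide d) (anchor-∷ʳ y)

module CyclePosition {k : ℕ} {E : List (OEdge k)} (tree : IsTree k E) {s t : Fin k} (st∈E : (s , t) ∈ E)
                     (m : ℕ) {j : ℕ} (w : Word k j) (first : FirstNotIn s t w) where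

  open TreeSides tree st∈E using (side; side-s; side-t; side-edge)
  open Shadow side side-s side-t

  -- The value for j = 0 is irrelevant: there every suffix equals w.
  headSide : Word k j → Bool
  headSide []      = false
  headSide (c ∷ _) = side c

  headSide-moved : ∀ {p q} → side p ≡ side q → (r : Word k j) → act (p , q) r ≢ r →
                   headSide r ≡ side p × headSide (act (p , q) r) ≡ side p
  headSide-moved sides []      moved = contradiction refl moved
  headSide-moved {p} {q} sides (c ∷ r) moved with c ≟ᶠ p | c ≟ᶠ q
  ... | yes refl | _    = refl , sym sides
  ... | no _ | yes refl = sym sides , refl
  ... | no _ | no _     = contradiction refl moved

  act-++-w : (y : Word k m) → act (s , t) (y ++ w) ≡ act (s , t) y ++ w
  act-++-w y with act-++ s t y w
  ... | inj₁ eq       = eq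
  ... | inj₂ (_ , eq) = trans eq (cong (act (s , t) y ++_) (act-FirstNotIn w first))

  act-++-≢w : (y : Word k m) {r : Word k j} → r ≢ w →
              ∃[ r′ ] r′ ≢ w × act (s , t) (y ++ r) ≡ act (s , t) y ++ r′
  act-++-≢w y {r} r≢w with act-++ s t y r
  ... | inj₁ eq       = r , r≢w , eq
  ... | inj₂ (_ , eq) = act (s , t) r , (λ act-r≡w → r≢w (trans (sym (fixes act-r≡w)) act-r≡w)) , eq
    where
    fixes : act (s , t) r ≡ w → act (s , t) r ≡ r
    fixes act-r≡w = act-to-FirstNotIn r (subst (FirstNotIn s t) (sym act-r≡w) first)

  splitPosition : Word k m → Word k j → Vec Bool m
  splitPosition y r with r ≟ʷ w
  ... | yes _ = shadow y
  ... | no _  = replicate m (headSide w)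

  splitPosition-w : (y : Word k m) → splitPosition y w ≡ shadow y
  splitPosition-w y with w ≟ʷ w
  ... | yes _   = refl
  ... | no w≢w = contradiction refl w≢w

  splitPosition-≢w : (y : Word k m) {r : Word k j} → r ≢ w → splitPosition y r ≡ replicate m (headSide w)
  splitPosition-≢w y {r} r≢w with r ≟ʷ w
  ... | yes r≡w = contradiction r≡w r≢w
  ... | no _    = refl

  -- The vertex of the e-cycle of w from which z hangs: only the e-edges of that cycle change it
  -- (adj-position).
  position : Word k (m + j) → Vec Bool m
  position z = splitPosition (take m z) (drop m z)

  position-++ : (y : Word k m) (r : Word k j) → position (y ++ r) ≡ splitPosition y r
  position-++ y r = cong₂ splitPosition (++-injectiveˡ (take m (y ++ r)) y split)
                                         (++-injectiveʳ (take m (y ++ r)) y split)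
    where split = take++drop≡id m (y ++ r)

  cycleWord : Vec Bool m → Word k (m + j)
  cycleWord b = stWord s t b ++ w

  position-cycleWord : (b : Vec Bool m) → position (cycleWord b) ≡ b
  position-cycleWord b = trans (position-++ _ w) (trans (splitPosition-w _) (proj₁ (shadow-stWord b)))

  act-cycleWord : (b : Vec Bool m) → act (s , t) (cycleWord b) ≡ cycleWord (inc b)
  act-cycleWord b = trans (act-++-w (stWord s t b)) (cong (_++ w) (act-stWord s≢t b))

  FibreOrCycleStep : Word k (m + j) → Word k (m + j) → Set
  FibreOrCycleStep z z′ = position z′ ≡ position z
                        ⊎ (z ≡ cycleWord (position z) × z′ ≡ cycleWord (inc (position z)))

  splitPosition-act-replicate : ∀ {p q} → side p ≡ side q → (r : Word k j) →
    splitPosition (act (p , q) (replicate m p)) (act (p , q) r) ≡ splitPosition (replicate m p) r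
  splitPosition-act-replicate {p} {q} sides r with w ≟ʷ r | w ≟ʷ act (p , q) r
  ... | yes refl | yes w≡act-w = begin
    splitPosition (act (p , q) (replicate m p)) (act (p , q) w)  ≡⟨ cong (splitPosition _) (sym w≡act-w) ⟩
    splitPosition (act (p , q) (replicate m p)) w                ≡⟨ splitPosition-w _ ⟩
    shadow (act (p , q) (replicate m p))                         ≡⟨ proj₁ (shadow-act sides (replicate m p)) ⟩
    shadow (replicate m p)                                       ≡⟨ sym (splitPosition-w _) ⟩
    splitPosition (replicate m p) w                              ∎
    where open ≡-Reasoning
  ... | yes refl | no w≢act-w = begin
    splitPosition (act (p , q) (replicate m p)) (act (p , q) w)  ≡⟨ splitPosition-≢w _ (w≢act-w ∘ sym) ⟩
    replicate m (headSide w)                                     ≡⟨ cong (replicate m) (proj₁ (headSide-moved sides w (w≢act-w ∘ sym))) ⟩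
    replicate m (side p)                                         ≡⟨ sym (shadow-replicate m p) ⟩
    shadow (replicate m p)                                       ≡⟨ sym (splitPosition-w _) ⟩
    splitPosition (replicate m p) w                              ∎
    where open ≡-Reasoning
  ... | no w≢r | yes w≡act-r = begin
    splitPosition (act (p , q) (replicate m p)) (act (p , q) r)  ≡⟨ cong₂ splitPosition (act-replicate p q m) (sym w≡act-r) ⟩
    splitPosition (replicate m q) w                              ≡⟨ splitPosition-w _ ⟩
    shadow (replicate m q)                                       ≡⟨ shadow-replicate m q ⟩
    replicate m (side q)                                         ≡⟨ cong (replicate m) (sym (trans head-act-r sides)) ⟩
    replicate m (headSide w)                                     ≡⟨ sym (splitPosition-≢w _ (w≢r ∘ sym)) ⟩
    splitPosition (replicate m p) r                              ∎
    where
    open ≡-Reasoning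
    head-act-r : headSide w ≡ side p
    head-act-r = trans (cong headSide w≡act-r)
                       (proj₂ (headSide-moved sides r (λ act-r≡r → w≢r (trans w≡act-r act-r≡r))))
  ... | no w≢r | no w≢act-r =
    trans (splitPosition-≢w _ (w≢act-r ∘ sym)) (sym (splitPosition-≢w _ (w≢r ∘ sym)))

  position-act-sameSide : ∀ {p q} → side p ≡ side q → (y : Word k m) (r : Word k j) →
    position (act (p , q) (y ++ r)) ≡ position (y ++ r)
  position-act-sameSide {p} {q} sides y r with act-++ p q y r
  ... | inj₁ eq = begin
    position (act (p , q) (y ++ r))  ≡⟨ cong position eq ⟩
    position (act (p , q) y ++ r)    ≡⟨ position-++ _ r ⟩
    splitPosition (act (p , q) y) r  ≡⟨ same-shadow r ⟩
    splitPosition y r                ≡⟨ sym (position-++ y r) ⟩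
    position (y ++ r)                ∎
    where
    open ≡-Reasoning
    same-shadow : ∀ r → splitPosition (act (p , q) y) r ≡ splitPosition y r
    same-shadow r with w ≟ʷ r
    ... | yes refl = trans (splitPosition-w _) (trans (proj₁ (shadow-act sides y)) (sym (splitPosition-w y)))
    ... | no w≢r  = trans (splitPosition-≢w _ (w≢r ∘ sym)) (sym (splitPosition-≢w y (w≢r ∘ sym)))
  ... | inj₂ (refl , eq) = begin
    position (act (p , q) (y ++ r))                              ≡⟨ cong position eq ⟩
    position (act (p , q) y ++ act (p , q) r)                    ≡⟨ position-++ (act (p , q) y) (act (p , q) r) ⟩
    splitPosition (act (p , q) y) (act (p , q) r)                ≡⟨ splitPosition-act-replicate sides r ⟩
    splitPosition y r                                            ≡⟨ sym (position-++ y r) ⟩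
    position (y ++ r)                                            ∎
    where open ≡-Reasoning

  cycle-step : (b : Vec Bool m) → FibreOrCycleStep (cycleWord b) (act (s , t) (cycleWord b))
  cycle-step b = inj₂ (cong cycleWord (sym (position-cycleWord b)) ,
                       trans (act-cycleWord b) (cong (cycleWord ∘ inc) (sym (position-cycleWord b))))

  position-act-st : (y : Word k m) (r : Word k j) → FibreOrCycleStep (y ++ r) (act (s , t) (y ++ r))
  position-act-st y r with w ≟ʷ r
  ... | no w≢r = let (r′ , r′≢w , eq) = act-++-≢w y (w≢r ∘ sym) in inj₁ (begin
    position (act (s , t) (y ++ r))   ≡⟨ cong position eq ⟩
    position (act (s , t) y ++ r′)    ≡⟨ position-++ _ r′ ⟩
    splitPosition (act (s , t) y) r′  ≡⟨ splitPosition-≢w _ r′≢w ⟩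
    replicate m (headSide w)          ≡⟨ sym (splitPosition-≢w y (w≢r ∘ sym)) ⟩
    splitPosition y r                 ≡⟨ sym (position-++ y r) ⟩
    position (y ++ r)                 ∎)
    where open ≡-Reasoning
  ... | yes refl with anchor y in anchor-y
  ...   | just _  = inj₁ (begin
    position (act (s , t) (y ++ w))   ≡⟨ cong position (act-++-w y) ⟩
    position (act (s , t) y ++ w)     ≡⟨ position-++ _ w ⟩
    splitPosition (act (s , t) y) w   ≡⟨ splitPosition-w _ ⟩
    shadow (act (s , t) y)            ≡⟨ proj₁ (shadow-act-st y anchor-y) ⟩
    shadow y                          ≡⟨ sym (splitPosition-w y) ⟩
    splitPosition y w                 ≡⟨ sym (position-++ y w) ⟩
    position (y ++ w)                 ∎)
    where open ≡-Reasoning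
  ...   | nothing = subst (λ z → FibreOrCycleStep z (act (s , t) z))
                          (sym (cong (_++ w) (anchor-nothing y anchor-y))) (cycle-step (shadow y))

  position-act : ∀ {p q} → (p , q) ∈ E → (z : Word k (m + j)) → FibreOrCycleStep z (act (p , q) z)
  position-act {p} {q} pq∈E z with (p , q) ≟ₑ (s , t)
  ... | yes refl = subst (λ z → FibreOrCycleStep z (act (s , t) z)) (take++drop≡id m z)
                         (position-act-st (take m z) (drop m z))
  ... | no pq≢st = inj₁ (subst (λ z → position (act (p , q) z) ≡ position z) (take++drop≡id m z)
                               (position-act-sameSide (side-edge pq∈E pq≢st) (take m z) (drop m z)))

  adj-position : ∀ {z z′ : Word k (m + j)} → Adj E z z′ → FibreOrCycleStep z z′ ⊎ FibreOrCycleStep z′ z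
  adj-position {z = z}  (_ , f∈E , inj₁ refl) = inj₁ (position-act f∈E z)
  adj-position {z′ = z′} (_ , f∈E , inj₂ refl) = inj₂ (position-act f∈E z′)

-- The e-cycle through u

module SchreierCycle {k : ℕ} {E : List (OEdge k)} (tree : IsTree k E) {s t : Fin k} (st∈E : (s , t) ∈ E)
                     (i : ℕ) {j : ℕ} (w : Word k j) (first : FirstNotIn s t w) where

  open TreeSides tree st∈E using (side; side-s; side-t)
  open Shadow side side-s side-t using (shadow; shadow-∷ʳ-st; shadow-∷ʳ-other)
  open CyclePosition tree st∈E (suc i) w first

  private
    n = suc i + j
    variable
      z z′ : Word k n

  pos : Word k n → ℕ
  pos z = value (position z)

  vertex : ℕ → Word k n
  vertex p = cycleWord (bits (suc i) p)

  cycleWord≡vertex : (b : Vec Bool (suc i)) → cycleWord b ≡ vertex (value b)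
  cycleWord≡vertex b = cong cycleWord (sym (bits-value b))

  cycleWord-inc≡vertex : (b : Vec Bool (suc i)) → cycleWord (inc b) ≡ vertex (suc (value b))
  cycleWord-inc≡vertex b = cong (cycleWord ∘ inc) (sym (bits-value b))

  pos-vertex : ∀ {p} → p < 2 * 2 ^ i → pos (vertex p) ≡ p
  pos-vertex {p} p<2^m = trans (cong value (position-cycleWord (bits (suc i) p))) (value-bits p<2^m)

  adj-pos : Adj E z z′ → pos z ≡ pos z′
                       ⊎ (z ≡ vertex (pos z) × z′ ≡ vertex (suc (pos z)))
                       ⊎ (z′ ≡ vertex (pos z′) × z ≡ vertex (suc (pos z′)))
  adj-pos z∼z′ with adj-position z∼z′
  ... | inj₁ (inj₁ same)        = inj₁ (cong value (sym same))
  ... | inj₁ (inj₂ (z≡ , z′≡)) =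
    inj₂ (inj₁ (trans z≡ (cycleWord≡vertex _) , trans z′≡ (cycleWord-inc≡vertex _)))
  ... | inj₂ (inj₁ same)        = inj₁ (cong value same)
  ... | inj₂ (inj₂ (z′≡ , z≡)) =
    inj₂ (inj₂ (trans z′≡ (cycleWord≡vertex _) , trans z≡ (cycleWord-inc≡vertex _)))

  open CycleRetraction E (2 ^ i) pos vertex (value< ∘ position) pos-vertex
    (cong cycleWord ∘ bits-periodic (suc i)) (λ p → (s , t) , st∈E , inj₁ (act-cycleWord (bits (suc i) p)))
    adj-pos (Γ-connected (proj₂ tree))

  Counts : Word k n → Word k n → Set
  Counts u v = ∃₂ λ N M → HasCount (Closer E u v) N × HasCount (Closer E v u) M
                          × N * M ≡ k ^ i * (k ^ n ∸ k ^ i)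

  module ArcCount (c : ℕ) (c+1<h : suc c < 2 ^ i) where

    open Arc c c+1<h

    pick : Word k i → Fin k
    pick y with value (shadow y) ≤? c
    ... | yes _ = s
    ... | no _  = t

    arcWord : Word k i → Word k n
    arcWord y = (y ∷ʳ pick y) ++ w

    pos-∷ʳs++w : (y : Word k i) → pos ((y ∷ʳ s) ++ w) ≡ value (shadow y) + 2 ^ i
    pos-∷ʳs++w y = begin
      value (position ((y ∷ʳ s) ++ w))  ≡⟨ cong value (trans (position-++ (y ∷ʳ s) w) (splitPosition-w _)) ⟩
      value (shadow (y ∷ʳ s))           ≡⟨ cong value (shadow-∷ʳ-st y (inj₁ refl)) ⟩
      value (shadow y ∷ʳ side s)        ≡⟨ cong (value ∘ (shadow y ∷ʳ_)) side-s ⟩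
      value (shadow y ∷ʳ false)         ≡⟨ value-∷ʳ-false (shadow y) ⟩
      value (shadow y) + 2 ^ i          ∎
      where open ≡-Reasoning

    pos-∷ʳt++w : (y : Word k i) → pos ((y ∷ʳ t) ++ w) ≡ value (shadow y)
    pos-∷ʳt++w y = begin
      value (position ((y ∷ʳ t) ++ w))  ≡⟨ cong value (trans (position-++ (y ∷ʳ t) w) (splitPosition-w _)) ⟩
      value (shadow (y ∷ʳ t))           ≡⟨ cong value (shadow-∷ʳ-st y (inj₂ refl)) ⟩
      value (shadow y ∷ʳ side t)        ≡⟨ cong (value ∘ (shadow y ∷ʳ_)) side-t ⟩
      value (shadow y ∷ʳ true)          ≡⟨ value-∷ʳ-true (shadow y) ⟩
      value (shadow y)                  ∎
      where open ≡-Reasoning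

    inside-arcWord : (y : Word k i) → Inside (arcWord y)
    inside-arcWord y with value (shadow y) ≤? c
    ... | yes v≤c = subst InArc (sym (pos-∷ʳs++w y))
                      (<-≤-trans (<-trans (n<1+n c) c+1<h) (m≤n+m _ _) , +-monoˡ-≤ (2 ^ i) v≤c)
    ... | no v≰c  = subst InArc (sym (pos-∷ʳt++w y))
                      (≰⇒> v≰c , ≤-trans (<⇒≤ (value< (shadow y))) (m≤n+m _ c))

    pick-s : ∀ y → value (shadow y) ≤ c → pick y ≡ s
    pick-s y v≤c with value (shadow y) ≤? c
    ... | yes _   = refl
    ... | no v≰c = contradiction v≤c v≰c

    pick-t : ∀ y → ¬ value (shadow y) ≤ c → pick y ≡ t
    pick-t y v≰c with value (shadow y) ≤? c
    ... | yes v≤c = contradiction v≤c v≰c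
    ... | no _    = refl

    outside-replicate : ∀ σ → ¬ InArc (value (replicate (suc i) σ))
    outside-replicate true (c<0 , _) = contradiction (subst (c <_) (value-replicate-true (suc i)) c<0) λ ()
    outside-replicate false          = ¬InArc-last (1+value-replicate-false (suc i))

    inside⇒arcWord-++ : (y′ : Word k (suc i)) (r : Word k j) → Inside (y′ ++ r) → ∃[ y ] y′ ++ r ≡ arcWord y
    inside⇒arcWord-++ y′ r inside with w ≟ʷ r
    ... | no w≢r = contradiction (subst InArc pos≡ inside) (outside-replicate (headSide w))
      where pos≡ = cong value (trans (position-++ y′ r) (splitPosition-≢w y′ (w≢r ∘ sym)))
    ... | yes refl with initLast y′
    ...   | y , l , refl with letter s t l
    ...     | is-other l≢s l≢t = contradiction (subst InArc pos≡ inside) (outside-replicate (side l))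
      where pos≡ = cong value (trans (position-++ _ w) (trans (splitPosition-w _) (shadow-∷ʳ-other y l≢s l≢t)))
    ...     | is-s = y , cong (λ l → (y ∷ʳ l) ++ w) (sym (pick-s y (+-cancelʳ-≤ (2 ^ i) _ _ v+h≤c+h)))
      where
      v+h≤c+h : value (shadow y) + 2 ^ i ≤ c + 2 ^ i
      v+h≤c+h = subst (_≤ c + 2 ^ i) (pos-∷ʳs++w y) (proj₂ inside)
    ...     | is-t = y , cong (λ l → (y ∷ʳ l) ++ w) (sym (pick-t y (<⇒≱ c<v)))
      where
      c<v : c < value (shadow y)
      c<v = subst (c <_) (pos-∷ʳt++w y) (proj₁ inside)

    arcWord-injective : ∀ {y y′} → arcWord y ≡ arcWord y′ → y ≡ y′
    arcWord-injective {y} {y′} eq = ∷ʳ-injectiveˡ y y′ (++-injectiveˡ (y ∷ʳ pick y) (y′ ∷ʳ pick y′) eq)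

    inside-count : HasCount Inside (k ^ i)
    inside-count = map arcWord (words k i) , Unique.map⁺ arcWord-injective (words-unique k i) ,
                   (λ z → listed⇒inside , inside⇒listed z) , trans (length-map arcWord (words k i)) (length-words k i)
      where
      listed⇒inside : ∀ {z} → z ∈ map arcWord (words k i) → Inside z
      listed⇒inside z∈ with y , _ , refl ← ∈-map⁻ arcWord z∈ = inside-arcWord y
      inside⇒listed : ∀ z → Inside z → z ∈ map arcWord (words k i)
      inside⇒listed z inside with y , z≡ ← inside⇒arcWord-++ (take (suc i) z) (drop (suc i) z)
                                              (subst Inside (sym (take++drop≡id (suc i) z)) inside) =
        subst (_∈ map arcWord (words k i)) (trans (sym z≡) (take++drop≡id (suc i) z)) (∈-map⁺ arcWord (∈-words y))

    outside-count : HasCount (∁ Inside) (k ^ n ∸ k ^ i)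
    outside-count = HasCount-∁ inside? inside-count (HasCount-words k n)

    upper-counts : Counts upperIn upperOut
    upper-counts = _ , _ , HasCount-cong (⇔-sym ∘ proj₁ ∘ closer-upper) inside-count
                         , HasCount-cong (⇔-sym ∘ proj₂ ∘ closer-upper) outside-count , refl

    lower-counts : Counts lowerOut lowerIn
    lower-counts = _ , _ , HasCount-cong (⇔-sym ∘ proj₂ ∘ closer-lower) outside-count
                         , HasCount-cong (⇔-sym ∘ proj₁ ∘ closer-lower) inside-count , *-comm _ (k ^ i)

  -- If value x ≥ h the arc of u avoids both ends 0 and 2h - 1 of the numbering, otherwise that of v does.
  closer-counts : (x : Vec Bool (suc i)) → ¬ SpecialPattern x → Counts (cycleWord x) (act (s , t) (cycleWord x))
  closer-counts x ¬special with 2 ^ i ≤? value x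
  ... | yes h≤v = subst₂ Counts (sym u≡upperIn) (sym v≡upperOut) (ArcCount.upper-counts c c+1<h)
    where
    c = value x ∸ 2 ^ i
    v≡c+h : value x ≡ c + 2 ^ i
    v≡c+h = sym (m∸n+n≡m h≤v)
    u≡upperIn : cycleWord x ≡ vertex (c + 2 ^ i)
    u≡upperIn = trans (cycleWord≡vertex x) (cong vertex v≡c+h)
    v≡upperOut : act (s , t) (cycleWord x) ≡ vertex (suc (c + 2 ^ i))
    v≡upperOut = trans (act-cycleWord x) (trans (cycleWord-inc≡vertex x) (cong (vertex ∘ suc) v≡c+h))
    c+1<h : suc c < 2 ^ i
    c+1<h = +-cancelʳ-< (2 ^ i) (suc c) (2 ^ i)
              (subst₂ _<_ (cong suc v≡c+h) (cong (2 ^ i +_) (+-identityʳ (2 ^ i))) (≤∧≢⇒< (value< x) not-last))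
      where
      not-last : suc (value x) ≢ 2 ^ suc i
      not-last eq = ¬special (inj₁ (value-injective (suc-injective (trans eq (sym (1+value-replicate-false (suc i)))))))
  ... | no h≰v = subst₂ Counts (sym (cycleWord≡vertex x))
                               (sym (trans (act-cycleWord x) (cycleWord-inc≡vertex x)))
                               (ArcCount.lower-counts (value x) (≤∧≢⇒< (≰⇒> h≰v) not-middle))
    where
    not-middle : suc (value x) ≢ 2 ^ i
    not-middle eq = ¬special (inj₂ (value-injective (suc-injective (trans eq (sym middle)))))
      where
      middle : suc (value (replicate i false ∷ʳ true)) ≡ 2 ^ i
      middle = trans (cong suc (value-∷ʳ-true (replicate i false))) (1+value-replicate-false i)

mainTheorem8 : (k : ℕ) (E : List (OEdge k)) → IsTree k E →
  (s t : Fin k) → (s , t) ∈ E →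
  (i j : ℕ) (x : Vec Bool (suc i)) (w : Vec (Fin k) j) →
  FirstNotIn s t w → ¬ SpecialPattern x →
  let u = stWord s t x ++ w
      v = act (s , t) u
  in ∃₂ λ N M → HasCount (Closer E u v) N × HasCount (Closer E v u) M
     × N * M ≡ k ^ i * (k ^ (suc i + j) ∸ k ^ i)
mainTheorem8 k E tree s t st∈E i j x w first ¬special =
  SchreierCycle.closer-counts tree st∈E i w first x ¬special
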